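{- Every weakly graphic homogeneous relation $H$ of local congruence $2$ is modular quotient.
   Context: A diverse triple of a finite set $X$ is $(x,y,z)\in X^3$ with $x\neq y$, $x\neq z$, written $(x|yz)$. A homogeneous relation $H$ on $X$ is a relation on diverse triples such that for every $x\in X$ the relation $H_x(y,z)\Leftrightarrow H(x|yz)$ is an equivalence relation on $X\setminus\{x\}$. The congruence of $x$ is the number of equivalence classes of $H_x$, and the local congruence of $H$ is the maximum congruence over all $x\in X$. $M\subseteq X$ is a homogeneous module if $H(x|mm')$ for all $m,m'\in M$, $x\in X\setminus M$. $H$ is weakly graphic if $H(y|xz)\wedge H(z|xy)\Rightarrow H(x|yz)$ for all pairwise distinct $x,y,z$; modular quotient if for every homogeneous module $M$, all $x,y\in M$ and all $s,t\notin M$, $H(x|st)\Leftrightarrow H(y|st)$. -}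

module Defs where

open import Data.Nat using (ℕ; _≤_)
open import Data.Fin using (Fin)
open import Data.Bool using (Bool; true; false)
open import Data.Product using (Σ; ∃; _×_; _,_)
open import Relation.Binary.PropositionalEquality using (_≡_; _≢_)
open import Relation.Nullary using (¬_)

-- Only its values on
-- diverse triples (x|yz) (x ≢ y, x ≢ z) are ever used; values on other
-- triples are irrelevant.  H x y z ≡ true means H(x|yz).
Rel3 : ℕ → Set
Rel3 n = Fin n → Fin n → Fin n → Bool

module _ {n : ℕ} (H : Rel3 n) where

  Hr : Fin n → Fin n → Fin n → Set
  Hr x y z = H x y z ≡ true

  IsHomogeneous : Set
  IsHomogeneous =
      (∀ x y → x ≢ y → Hr x y y)
    × (∀ x y z → x ≢ y → x ≢ z → Hr x y z → Hr x z y)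
    × (∀ x y z w → x ≢ y → x ≢ z → x ≢ w → Hr x y z → Hr x z w → Hr x y w)

  -- x has congruence k: H_x has exactly k equivalence classes, i.e. there is
  -- a surjective class-labelling c : X \ {x} → Fin k with H_x(y,z) ⇔ c y ≡ c z.
  HasCongruence : Fin n → ℕ → Set
  HasCongruence x k =
    Σ ((y : Fin n) → y ≢ x → Fin k) λ c →
        (∀ (i : Fin k) → ∃ λ y → Σ (y ≢ x) λ p → c y p ≡ i)
      × (∀ y z (p : y ≢ x) (q : z ≢ x) → (Hr x y z → c y p ≡ c z q)
                                          × (c y p ≡ c z q → Hr x y z))

  HasLocalCongruence : ℕ → Set
  HasLocalCongruence k =
      (∀ x → ∃ λ j → j ≤ k × HasCongruence x j)
    × (∃ λ x → HasCongruence x k)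

  IsWeaklyGraphic : Set
  IsWeaklyGraphic = ∀ x y z → x ≢ y → x ≢ z → y ≢ z →
    Hr y x z → Hr z x y → Hr x y z

  IsHomogeneousModule : (Fin n → Bool) → Set
  IsHomogeneousModule M = ∀ x m m' → M x ≡ false → M m ≡ true → M m' ≡ true →
    Hr x m m'

  IsModularQuotient : Set
  IsModularQuotient = ∀ (M : Fin n → Bool) → IsHomogeneousModule M →
    ∀ x y s t → M x ≡ true → M y ≡ true → M s ≡ false → M t ≡ false →
    (Hr x s t → Hr y s t) × (Hr y s t → Hr x s t)

-- Let x, y lie in a homogeneous module and s, t outside it, with H(x|st); then
-- H(s|xy) and H(t|xy).  As y has congruence at most 2, two of x, s, t are
-- H_y-equivalent.  If they are s, t we are done.  If they are x, s (x, t is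
-- symmetric), weak graphicity turns H(y|xs), H(s|xy) into H(x|ys), transitivity
-- of H_x with H(x|st) gives H(x|yt), weak graphicity with H(t|xy) gives H(y|xt),
-- and transitivity of H_y yields H(y|st).
module Submission where

open import Defs
open import Data.Nat using (ℕ; _≤_; s≤s)
open import Data.Fin using (Fin; zero; suc; _≟_)
open import Data.Fin.Properties using (pigeonhole)
open import Data.Bool using (Bool; true; false)
open import Data.Product using (_,_; proj₂)
open import Data.Sum using (_⊎_; inj₁; inj₂)
import Data.Sum as Sum
open import Relation.Binary.PropositionalEquality using (_≡_; _≢_; refl; sym; trans; ≢-sym)
open import Relation.Nullary using (yes; no)

two-of-three-equal : ∀ {j} → j ≤ 2 → (a b c : Fin j) → a ≡ b ⊎ a ≡ c ⊎ b ≡ c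
two-of-three-equal j≤2 a b c with pigeonhole (s≤s j≤2) triple
  where
  triple : Fin 3 → Fin _
  triple zero = a
  triple (suc zero) = b
  triple (suc (suc zero)) = c
... | zero , suc zero , _ , a≡b = inj₁ a≡b
... | zero , suc (suc zero) , _ , a≡c = inj₂ (inj₁ a≡c)
... | suc zero , suc (suc zero) , _ , b≡c = inj₂ (inj₂ b≡c)
... | suc _ , suc zero , s≤s () , _
... | suc (suc _) , suc (suc zero) , s≤s (s≤s ()) , _

inside≢outside : ∀ {n} (M : Fin n → Bool) {a b} → M a ≡ true → M b ≡ false → a ≢ b
inside≢outside M Ma Mb refl with trans (sym Ma) Mb
... | ()

module _ {n : ℕ} {H : Rel3 n} where

  two-of-three-related : ∀ {x j} → j ≤ 2 → HasCongruence H x j →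
    ∀ {a b c} → a ≢ x → b ≢ x → c ≢ x →
    Hr H x a b ⊎ Hr H x a c ⊎ Hr H x b c
  two-of-three-related {x} j≤2 (cls , _ , cls-spec) a≢x b≢x c≢x =
    Sum.map (related a≢x b≢x) (Sum.map (related a≢x c≢x) (related b≢x c≢x))
      (two-of-three-equal j≤2 (cls _ a≢x) (cls _ b≢x) (cls _ c≢x))
    where
    related : ∀ {y z} (p : y ≢ x) (q : z ≢ x) → cls y p ≡ cls z q → Hr H x y z
    related p q = proj₂ (cls-spec _ _ p q)

  module _ (homogeneous : IsHomogeneous H) (weakly-graphic : IsWeaklyGraphic H) where

    private
      H-sym : ∀ {x y z} → x ≢ y → x ≢ z → Hr H x y z → Hr H x z y
      H-sym = let (_ , sym′ , _) = homogeneous in sym′ _ _ _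

      H-trans : ∀ {x y z w} → x ≢ y → x ≢ z → x ≢ w → Hr H x y z → Hr H x z w → Hr H x y w
      H-trans = let (_ , _ , trans′) = homogeneous in trans′ _ _ _ _

    transfer-via-shared-class : ∀ {x y s t} → x ≢ y → x ≢ s → x ≢ t → y ≢ s → y ≢ t →
      Hr H s x y → Hr H t x y → Hr H y x s → Hr H x s t → Hr H y s t
    transfer-via-shared-class {x} {y} {s} {t} x≢y x≢s x≢t y≢s y≢t Hsxy Htxy Hyxs Hxst =
      H-trans y≢s y≢x y≢t (H-sym y≢x y≢s Hyxs) Hyxt
      where
      y≢x : y ≢ x
      y≢x = ≢-sym x≢y
      Hxys : Hr H x y s
      Hxys = weakly-graphic _ _ _ x≢y x≢s y≢s Hyxs Hsxy
      Hxyt : Hr H x y t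
      Hxyt = H-trans x≢y x≢s x≢t Hxys Hxst
      Hyxt : Hr H y x t
      Hyxt = weakly-graphic _ _ _ y≢x y≢t x≢t Hxyt (H-sym (≢-sym x≢t) (≢-sym y≢t) Htxy)

    congruence≤2⇒transfer : ∀ {x y s t j} → j ≤ 2 → HasCongruence H y j →
      x ≢ y → x ≢ s → x ≢ t → y ≢ s → y ≢ t →
      Hr H s x y → Hr H t x y → Hr H x s t → Hr H y s t
    congruence≤2⇒transfer j≤2 cong x≢y x≢s x≢t y≢s y≢t Hsxy Htxy Hxst
      with two-of-three-related j≤2 cong x≢y (≢-sym y≢s) (≢-sym y≢t)
    ... | inj₁ Hyxs = transfer-via-shared-class x≢y x≢s x≢t y≢s y≢t Hsxy Htxy Hyxs Hxst
    ... | inj₂ (inj₁ Hyxt) = H-sym y≢t y≢s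
      (transfer-via-shared-class x≢y x≢t x≢s y≢t y≢s Htxy Hsxy Hyxt (H-sym x≢s x≢t Hxst))
    ... | inj₂ (inj₂ Hyst) = Hyst

proposition7 : (n : ℕ) (H : Rel3 n) → IsHomogeneous H → IsWeaklyGraphic H →
    HasLocalCongruence H 2 → IsModularQuotient H
proposition7 n H homogeneous weakly-graphic (congruence≤2 , _) M module′ x y s t Mx My Ms Mt =
  transfer Mx My , transfer My Mx
  where
  transfer : ∀ {u v} → M u ≡ true → M v ≡ true → Hr H u s t → Hr H v s t
  transfer {u} {v} Mu Mv Hust with u ≟ v | congruence≤2 v
  ... | yes refl | _ = Hust
  ... | no u≢v | _ , j≤2 , cong =
    congruence≤2⇒transfer homogeneous weakly-graphic j≤2 cong
      u≢v (inside≢outside M Mu Ms) (inside≢outside M Mu Mt)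
      (inside≢outside M Mv Ms) (inside≢outside M Mv Mt)
      (module′ s u v Ms Mu Mv) (module′ t u v Mt Mu Mv) Hust
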